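{- For any connected graph $G$, $pd_s(G)\le \alpha(G_{SR})+1$.
   Context: All graphs are finite, simple and connected; $d_G$ is the shortest-path distance and $d_G(x,W)=\min\{d_G(x,w):w\in W\}$. A set $W$ of vertices strongly resolves two different vertices $x,y\notin W$ if $d_G(x,W)=d_G(x,y)+d_G(y,W)$ or $d_G(y,W)=d_G(y,x)+d_G(x,W)$. An ordered vertex partition $\Pi$ of $G$ is a strong resolving partition if every two different vertices in the same set of $\Pi$ are strongly resolved by some set of $\Pi$; $pd_s(G)$ is the minimum cardinality of a strong resolving partition. A vertex $u$ is maximally distant from $v$ if $d_G(v,w)\le d_G(u,v)$ for every neighbor $w$ of $u$; $u,v$ are mutually maximally distant if each is maximally distant from the other. The boundary $\partial(G)$ is the set of vertices $u$ for which some $v$ exists with $u,v$ mutually maximally distant. The strong resolving graph $G_{SR}$ has vertex set $\partial(G)$, two vertices being adjacent iff they are mutually maximally distant in $G$. $\alpha(H)$ denotes the vertex cover number of a graph $H$. -}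

module Defs where

open import Data.Nat using (ℕ; zero; suc; _≤_; _+_; _⊓_)
open import Data.Bool using (Bool; true; false; _∨_; _∧_; if_then_else_)
open import Data.Fin using (Fin; _≟_)
open import Data.Fin.Subset using (Subset; _∈_; ∣_∣)
open import Data.List using (List; foldr; allFin)
open import Data.Bool.ListAction using (any)
open import Data.Product using (Σ; ∃; _×_; _,_)
open import Data.Sum using (_⊎_)
open import Relation.Nullary using (¬_; ⌊_⌋)
open import Relation.Binary.PropositionalEquality using (_≡_; _≢_)

record Graph (n : ℕ) : Set where
  field
    adj    : Fin n → Fin n → Bool
    sym    : ∀ x y → adj x y ≡ adj y x
    irrefl : ∀ x → adj x x ≡ false
open Graph public

data Walk {n : ℕ} (G : Graph n) : Fin n → Fin n → ℕ → Set where
  nil  : ∀ {x} → Walk G x x 0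
  cons : ∀ {x y z k} → adj G x y ≡ true → Walk G y z k → Walk G x z (suc k)

Connected : ∀ {n} → Graph n → Set
Connected G = ∀ x y → ∃ λ k → Walk G x y k

reach : ∀ {n} → Graph n → ℕ → Fin n → Fin n → Bool
reach {n} G zero    x y = ⌊ x ≟ y ⌋
reach {n} G (suc k) x y =
  reach G k x y ∨ any (λ z → reach G k x z ∧ adj G z y) (allFin n)

search : ℕ → ℕ → (ℕ → Bool) → ℕ
search k zero    p = k
search k (suc f) p = if p k then k else search (suc k) f p

-- Shortest-path distance d_G(x,y): the least k with y within k steps of x
-- (in a connected graph on n vertices this is always < n).
dist : ∀ {n} → Graph n → Fin n → Fin n → ℕ
dist {n} G x y = search 0 n (λ k → reach G k x y)

-- d_G(x,W) = min {d_G(x,w) : w ∈ W}, for W given by a Bool predicate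
-- (the default value n is only used when W is empty, which never happens
-- for the sets of a partition below).
distSet : ∀ {n} → Graph n → Fin n → (Fin n → Bool) → ℕ
distSet {n} G x W =
  foldr (λ w acc → if W w then dist G x w ⊓ acc else acc) n (allFin n)

StronglyResolves : ∀ {n} → Graph n → (Fin n → Bool) → Fin n → Fin n → Set
StronglyResolves G W x y =
  W x ≡ false × W y ≡ false ×
  (distSet G x W ≡ dist G x y + distSet G y W
   ⊎ distSet G y W ≡ dist G y x + distSet G x W)

-- An ordered partition into k (nonempty) sets Π = (S_0,…,S_{k-1}) is given
-- by a surjection part : Fin n → Fin k, with S_i = part⁻¹(i).
partSet : ∀ {n k} → (Fin n → Fin k) → Fin k → (Fin n → Bool)
partSet part i w = ⌊ part w ≟ i ⌋

IsStrongResolvingPartition : ∀ {n} → Graph n → (k : ℕ) → (Fin n → Fin k) → Set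
IsStrongResolvingPartition {n} G k part =
  (∀ (i : Fin k) → ∃ λ x → part x ≡ i) ×
  (∀ (x y : Fin n) → x ≢ y → part x ≡ part y →
     ∃ λ (i : Fin k) → StronglyResolves G (partSet part i) x y)

IsStrongPartitionDimension : ∀ {n} → Graph n → ℕ → Set
IsStrongPartitionDimension {n} G p =
  (Σ (Fin n → Fin p) λ part → IsStrongResolvingPartition G p part) ×
  (∀ k (part : Fin n → Fin k) → IsStrongResolvingPartition G k part → p ≤ k)

MaxDistantFrom : ∀ {n} → Graph n → Fin n → Fin n → Set
MaxDistantFrom G u v = ∀ w → adj G u w ≡ true → dist G v w ≤ dist G u v

MutuallyMaxDistant : ∀ {n} → Graph n → Fin n → Fin n → Set
MutuallyMaxDistant G u v = MaxDistantFrom G u v × MaxDistantFrom G v u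

InBoundary : ∀ {n} → Graph n → Fin n → Set
InBoundary G u = ∃ λ v → MutuallyMaxDistant G u v

-- C is a vertex cover of G_SR: C ⊆ ∂(G) = V(G_SR), and every edge of G_SR
-- (pair of distinct mutually maximally distant vertices) has an end in C.
IsSRVertexCover : ∀ {n} → Graph n → Subset n → Set
IsSRVertexCover G C =
  (∀ u → u ∈ C → InBoundary G u) ×
  (∀ u v → u ≢ v → MutuallyMaxDistant G u v → u ∈ C ⊎ v ∈ C)

IsSRVertexCoverNumber : ∀ {n} → Graph n → ℕ → Set
IsSRVertexCoverNumber {n} G a =
  (Σ (Subset n) λ C → IsSRVertexCover G C × ∣ C ∣ ≡ a) ×
  (∀ (C : Subset n) → IsSRVertexCover G C → a ≤ ∣ C ∣)

module Submission where

-- Let C be a minimum vertex cover of the strong resolving graph G_SR.  Put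
-- every vertex of C into a class of its own and all remaining vertices into
-- one further class; this is a labelling with at most ∣C∣ + 1 labels.  Two
-- distinct vertices x, y with the same label both lie outside C.  Extend a
-- shortest y–x path beyond x to a vertex u maximally distant from y, then a
-- shortest u–y path beyond y to a vertex v maximally distant from u: u and v
-- are distinct and mutually maximally distant, so one of them lies in C, and
-- its singleton class strongly resolves x and y (x lies on a y–u geodesic and
-- y on an x–v geodesic).  Finally the labels actually used are renumbered,
-- which yields a genuine (surjective) strong resolving partition with at most
-- ∣C∣ + 1 classes.

open import Defs hiding (sym)
open import Data.Nat using (ℕ; zero; suc; _≤_; _<_; _+_; _⊓_; z≤n; s≤s; _<?_) renaming (_≟_ to _≟ℕ_)
open import Data.Nat.Properties
  using ( ≤-refl; ≤-trans; ≤-antisym; <-irrefl; <⇒≱; ≮⇒≥; m≤m+n; m≤n+m; m≤n⇒m≤1+n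
        ; m≤n⇒m<n∨m≡n; ≤∧≢⇒<; n≤0⇒n≡0; +-identityʳ; +-suc; +-comm; +-assoc
        ; +-mono-≤; +-monoʳ-≤; +-cancelˡ-≤; m+n≡0⇒m≡0; ⊓-idem; ⊓-assoc
        ; m≤n⇒m⊓n≡m; ≤-totalOrder; module ≤-Reasoning)
open import Data.Bool using (Bool; true; false; T; if_then_else_)
open import Data.Bool.Properties using (T-∨; T-∧; T-≡)
open import Data.Fin using (Fin; fromℕ; _≟_)
open import Data.Fin.Properties using (toℕ<n; suc-injective; any?; injective⇒≤)
open import Data.Fin.Subset using (Subset; _∈_; ∣_∣)
open import Data.Fin.Subset.Properties using (_∈?_)
open import Data.Vec using (_∷_; here; there)
open import Data.List using (List; []; _∷_; foldr; allFin; filter)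
open import Data.List.Relation.Unary.Any using (here; there; satisfied)
open import Data.List.Relation.Unary.Any.Properties using (any⁺; any⁻)
open import Data.List.Relation.Unary.All using (lookup)
open import Data.List.Relation.Unary.All.Properties using (all-filter)
open import Data.List.Membership.Propositional using (lose) renaming (_∈_ to _∈ˡ_)
open import Data.List.Membership.Propositional.Properties using (∈-allFin; ∈-filter⁺)
open import Data.List.Extrema ≤-totalOrder using (argmax; argmax-all; f[xs]≤f[argmax])
open import Data.Product using (Σ; ∃; _×_; _,_)
open import Data.Sum using (_⊎_; inj₁; inj₂; [_,_])
open import Function using (Equivalence; Injective)
open import Relation.Nullary using (¬_; ⌊_⌋; Dec; yes; no; contradiction)
open import Relation.Nullary.Decidable using (toWitness; fromWitness; isYes≗does; dec-false)
open import Relation.Binary.PropositionalEquality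
  using (_≡_; _≢_; refl; sym; trans; cong; cong₂; subst)

open Equivalence using (to; from)

⌊⌋-⇔ : ∀ {A B : Set} (a? : Dec A) (b? : Dec B) → (A → B) → (B → A) → ⌊ a? ⌋ ≡ ⌊ b? ⌋
⌊⌋-⇔ (yes _) (yes _) _  _  = refl
⌊⌋-⇔ (yes a) (no ¬b) f  _  = contradiction (f a) ¬b
⌊⌋-⇔ (no ¬a) (yes b) _  g  = contradiction (g b) ¬a
⌊⌋-⇔ (no _)  (no _)  _  _  = refl

⌊⌋-false : ∀ {A : Set} (a? : Dec A) → ¬ A → ⌊ a? ⌋ ≡ false
⌊⌋-false a? ¬a = trans (isYes≗does a?) (dec-false a? ¬a)

search-bounded : ∀ s f p → search s f p ≤ s + f
search-bounded s zero    p = m≤m+n s 0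
search-bounded s (suc f) p with p s
... | true  = m≤m+n s (suc f)
... | false = subst (search (suc s) f p ≤_) (sym (+-suc s f)) (search-bounded (suc s) f p)

search-least : ∀ s f p {j} → s ≤ j → T (p j) → search s f p ≤ j
search-least s zero    p s≤j pj = s≤j
search-least s (suc f) p {j} s≤j pj with p s in eq
... | true  = s≤j
... | false with s ≟ℕ j
...   | yes refl = contradiction (subst T eq pj) (λ ())
...   | no  s≢j  = search-least (suc s) f p (≤∧≢⇒< s≤j s≢j) pj

search-found : ∀ s f p → search s f p < s + f → T (p (search s f p))
search-found s zero    p lt = contradiction (subst (s <_) (+-identityʳ s) lt) (<-irrefl refl)
search-found s (suc f) p lt with p s in eq
... | true  = subst T (sym eq) _
... | false = search-found (suc s) f p (subst (search (suc s) f p <_) (+-suc s f) lt)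

singleton : ∀ {n} → Fin n → Fin n → Bool
singleton u w = ⌊ w ≟ u ⌋

module _ {n : ℕ} (G : Graph n) where

  private
    d : Fin n → Fin n → ℕ
    d = dist G

  snoc : ∀ {x y z k} → Walk G x y k → adj G y z ≡ true → Walk G x z (suc k)
  snoc nil        e′ = cons e′ nil
  snoc (cons e w) e′ = cons e (snoc w e′)

  unsnoc : ∀ {x z k} → Walk G x z (suc k) → ∃ λ y → Walk G x y k × adj G y z ≡ true
  unsnoc (cons e nil) = _ , nil , e
  unsnoc (cons e (cons e′ w)) with unsnoc (cons e′ w)
  ... | y , w′ , e″ = y , cons e w′ , e″

  _++ʷ_ : ∀ {x y z j k} → Walk G x y j → Walk G y z k → Walk G x z (j + k)
  nil      ++ʷ w′ = w′
  cons e w ++ʷ w′ = cons e (w ++ʷ w′)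

  reverse : ∀ {x y k} → Walk G x y k → Walk G y x k
  reverse nil                = nil
  reverse (cons {x} {y} e w) = snoc (reverse w) (trans (Graph.sym G y x) e)

  Reach : ℕ → Fin n → Fin n → Set
  Reach k x y = ∃ λ j → j ≤ k × Walk G x y j

  reach-sound : ∀ k {x y} → T (reach G k x y) → Reach k x y
  reach-sound zero    t with toWitness t
  ... | refl = 0 , z≤n , nil
  reach-sound (suc k) t with to T-∨ t
  ... | inj₁ t′ = let (j , j≤k , w) = reach-sound k t′ in j , m≤n⇒m≤1+n j≤k , w
  ... | inj₂ t′ with satisfied (any⁻ _ (allFin n) t′)
  ...   | z , tz with to T-∧ tz
  ...     | r , e = let (j , j≤k , w) = reach-sound k r in suc j , s≤s j≤k , snoc w (to T-≡ e)

  reach-complete : ∀ k {x y} → Reach k x y → T (reach G k x y)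
  reach-complete zero    (.0 , z≤n , nil) = fromWitness refl
  reach-complete (suc k) (j , j≤1+k , w) with m≤n⇒m<n∨m≡n j≤1+k
  ... | inj₁ (s≤s j≤k) = from T-∨ (inj₁ (reach-complete k (j , j≤k , w)))
  ... | inj₂ refl with unsnoc w
  ...   | z , w′ , e = from T-∨ (inj₂ (any⁺ _ (lose (∈-allFin z)
                         (from T-∧ (reach-complete k (k , ≤-refl , w′) , from T-≡ e)))))

  reach-sym : ∀ k {x y} → T (reach G k x y) → T (reach G k y x)
  reach-sym k t = let (j , j≤k , w) = reach-sound k t in reach-complete k (j , j≤k , reverse w)

  reach-trans : ∀ j k {x y z} → T (reach G j x y) → T (reach G k y z) → T (reach G (j + k) x z)
  reach-trans j k t t′ =
    let (i , i≤j , w) = reach-sound j t ; (i′ , i′≤k , w′) = reach-sound k t′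
    in reach-complete (j + k) (i + i′ , +-mono-≤ i≤j i′≤k , w ++ʷ w′)

  -- Metric properties of the shortest-path distance.  No connectivity is
  -- needed: a distance that reaches the cap n dominates every other distance.
  dist-bounded : ∀ x y → d x y ≤ n
  dist-bounded x y = search-bounded 0 n (λ k → reach G k x y)

  dist-least : ∀ k {x y} → T (reach G k x y) → d x y ≤ k
  dist-least k {x} {y} = search-least 0 n (λ k → reach G k x y) z≤n

  dist-attained : ∀ x y → d x y < n → T (reach G (d x y) x y)
  dist-attained x y = search-found 0 n (λ k → reach G k x y)

  dist-refl : ∀ x → d x x ≡ 0
  dist-refl x = n≤0⇒n≡0 (dist-least 0 (fromWitness refl))

  dist-adj : ∀ {x y} → adj G x y ≡ true → d x y ≤ 1
  dist-adj e = dist-least 1 (reach-complete 1 (1 , ≤-refl , cons e nil))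

  dist-sym≤ : ∀ x y → d x y ≤ d y x
  dist-sym≤ x y with d y x <? n
  ... | yes lt = dist-least (d y x) (reach-sym (d y x) (dist-attained y x lt))
  ... | no  ≮n = ≤-trans (dist-bounded x y) (≮⇒≥ ≮n)

  dist-sym : ∀ x y → d x y ≡ d y x
  dist-sym x y = ≤-antisym (dist-sym≤ x y) (dist-sym≤ y x)

  dist-triangle : ∀ x y z → d x z ≤ d x y + d y z
  dist-triangle x y z with d x y <? n | d y z <? n
  ... | yes lt | yes lt′ =
    dist-least (d x y + d y z) (reach-trans (d x y) (d y z) (dist-attained x y lt) (dist-attained y z lt′))
  ... | no ≮n | _      = ≤-trans (dist-bounded x z) (≤-trans (≮⇒≥ ≮n) (m≤m+n _ _))
  ... | yes _ | no ≮n  = ≤-trans (dist-bounded x z) (≤-trans (≮⇒≥ ≮n) (m≤n+m _ _))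

  dist-zero : ∀ x y → d x y ≡ 0 → x ≡ y
  dist-zero x y d≡0 = toWitness (subst (λ k → T (reach G k x y)) d≡0 (dist-attained x y d<n))
    where
    d<n : d x y < n
    d<n = subst (_< n) (sym d≡0) (≤-trans (s≤s z≤n) (toℕ<n x))

  private
    closer : Fin n → (Fin n → Bool) → Fin n → ℕ → ℕ
    closer x W w acc = if W w then d x w ⊓ acc else acc

  distSet-cong : ∀ x {W W′ : Fin n → Bool} → (∀ w → W w ≡ W′ w) → distSet G x W ≡ distSet G x W′
  distSet-cong x {W} {W′} W≗W′ = fold-cong (allFin n)
    where
    fold-cong : ∀ ws → foldr (closer x W) n ws ≡ foldr (closer x W′) n ws
    fold-cong []       = refl
    fold-cong (w ∷ ws) = cong₂ (λ b acc → if b then d x w ⊓ acc else acc) (W≗W′ w) (fold-cong ws)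

  distSet-singleton : ∀ x u → distSet G x (singleton u) ≡ d x u
  distSet-singleton x u = trans (fold-singleton n (allFin n) (∈-allFin u)) (m≤n⇒m⊓n≡m (dist-bounded x u))
    where
    fold : ℕ → List (Fin n) → ℕ
    fold = foldr (closer x (singleton u))

    absorb : ∀ b ws → d x u ⊓ fold b ws ≡ d x u ⊓ b
    absorb b []       = refl
    absorb b (w ∷ ws) with w ≟ u
    ... | yes refl = trans (sym (⊓-assoc (d x w) (d x w) _))
                       (trans (cong (_⊓ fold b ws) (⊓-idem (d x w))) (absorb b ws))
    ... | no  _    = absorb b ws

    fold-singleton : ∀ b ws → u ∈ˡ ws → fold b ws ≡ d x u ⊓ b
    fold-singleton b (w ∷ ws) u∈ with w ≟ u
    fold-singleton b (w ∷ ws) u∈          | yes refl = absorb b ws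
    fold-singleton b (w ∷ ws) (here refl) | no  w≢u  = contradiction refl w≢u
    fold-singleton b (w ∷ ws) (there u∈)  | no  _    = fold-singleton b ws u∈

  resolves-cong : ∀ {W W′} {x y} → (∀ w → W w ≡ W′ w) →
                  StronglyResolves G W x y → StronglyResolves G W′ x y
  resolves-cong {W} {W′} {x} {y} W≗W′ (Wx , Wy , geo)
    rewrite distSet-cong x W≗W′ | distSet-cong y W≗W′ =
    trans (sym (W≗W′ x)) Wx , trans (sym (W≗W′ y)) Wy , geo

  singleton-resolves : ∀ {x y u} → x ≢ u → y ≢ u →
                       d x u ≡ d x y + d y u ⊎ d y u ≡ d y x + d x u →
                       StronglyResolves G (singleton u) x y
  singleton-resolves {x} {y} {u} x≢u y≢u geo
    rewrite distSet-singleton x u | distSet-singleton y u =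
    ⌊⌋-false (x ≟ u) x≢u , ⌊⌋-false (y ≟ u) y≢u , geo

  OnGeodesic : Fin n → Fin n → Fin n → Set
  OnGeodesic a b t = d a t ≡ d a b + d b t

  -- A shortest path from a through b can be prolonged beyond b until it ends
  -- in a vertex t maximally distant from a: take t farthest from a among all
  -- vertices t with b on a shortest a–t path.
  geodesic-extension : ∀ a b → ∃ λ t → OnGeodesic a b t × MaxDistantFrom G t a
  geodesic-extension a b = t , on-t , maximally-distant
    where
    open ≤-Reasoning
    on-geodesic? : ∀ t → Dec (OnGeodesic a b t)
    on-geodesic? t = d a t ≟ℕ d a b + d b t

    candidates : List (Fin n)
    candidates = filter on-geodesic? (allFin n)

    on-b : OnGeodesic a b b
    on-b = sym (trans (cong (d a b +_) (dist-refl b)) (+-identityʳ _))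

    t : Fin n
    t = argmax (d a) b candidates

    on-t : OnGeodesic a b t
    on-t = argmax-all (d a) {P = OnGeodesic a b} on-b (all-filter on-geodesic? (allFin n))

    farthest : ∀ w → OnGeodesic a b w → d a w ≤ d a t
    farthest w on-w = lookup (f[xs]≤f[argmax] b candidates) (∈-filter⁺ on-geodesic? (∈-allFin w) on-w)

    beyond : ∀ w → adj G t w ≡ true → d a t < d a w → OnGeodesic a b w
    beyond w e lt = ≤-antisym (dist-triangle a b w) (begin
      d a b + d b w           ≤⟨ +-monoʳ-≤ (d a b) (dist-triangle b t w) ⟩
      d a b + (d b t + d t w) ≤⟨ +-monoʳ-≤ (d a b) (+-monoʳ-≤ (d b t) (dist-adj e)) ⟩
      d a b + (d b t + 1)     ≡⟨ sym (+-assoc (d a b) (d b t) 1) ⟩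
      d a b + d b t + 1       ≡⟨ cong (_+ 1) (sym on-t) ⟩
      d a t + 1               ≡⟨ +-comm (d a t) 1 ⟩
      suc (d a t)             ≤⟨ lt ⟩
      d a w                   ∎)

    maximally-distant : MaxDistantFrom G t a
    maximally-distant w e = subst (d a w ≤_) (dist-sym a t)
      (≮⇒≥ (λ lt → <⇒≱ lt (farthest w (beyond w e lt))))

  geodesic-loop : ∀ {a b} → OnGeodesic a b a → a ≡ b
  geodesic-loop {a} {b} on = dist-zero a b (m+n≡0⇒m≡0 (d a b) (trans (sym on) (dist-refl a)))

  geodesic-shift : ∀ {x y u v} → OnGeodesic y x u → OnGeodesic u y v → OnGeodesic x y v
  geodesic-shift {x} {y} {u} {v} on-x on-y =
    ≤-antisym (dist-triangle x y v) (+-cancelˡ-≤ (d u x) _ _ (begin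
      d u x + (d x y + d y v) ≡⟨ sym (+-assoc (d u x) (d x y) (d y v)) ⟩
      d u x + d x y + d y v   ≡⟨ cong (_+ d y v) (cong₂ _+_ (dist-sym u x) (dist-sym x y)) ⟩
      d x u + d y x + d y v   ≡⟨ cong (_+ d y v) (+-comm (d x u) (d y x)) ⟩
      d y x + d x u + d y v   ≡⟨ cong (_+ d y v) (sym on-x) ⟩
      d y u + d y v           ≡⟨ cong (_+ d y v) (dist-sym y u) ⟩
      d u y + d y v           ≡⟨ sym on-y ⟩
      d u v                   ≤⟨ dist-triangle u x v ⟩
      d u x + d x v           ∎))
    where open ≤-Reasoning

  distinct-ends : ∀ {x y u v} → x ≢ y → OnGeodesic y x u → OnGeodesic u y v → u ≢ v
  distinct-ends x≢y on-x on-y refl with geodesic-loop on-y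
  ... | refl = x≢y (sym (geodesic-loop on-x))

  between-boundary-pair : ∀ x y → x ≢ y → ∃ λ u → ∃ λ v →
    MutuallyMaxDistant G u v × u ≢ v × OnGeodesic y x u × OnGeodesic x y v
  between-boundary-pair x y x≢y with geodesic-extension y x
  ... | u , on-x , u-far with geodesic-extension u y
  ...   | v , on-y , v-far =
    u , v , (u-far-v , v-far) , distinct-ends x≢y on-x on-y , on-x , geodesic-shift on-x on-y
    where
    open ≤-Reasoning
    u-far-v : MaxDistantFrom G u v
    u-far-v w e = begin
      d v w         ≤⟨ dist-triangle v y w ⟩
      d v y + d y w ≤⟨ +-monoʳ-≤ (d v y) (u-far w e) ⟩
      d v y + d u y ≡⟨ cong (_+ d u y) (dist-sym v y) ⟩
      d y v + d u y ≡⟨ +-comm (d y v) (d u y) ⟩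
      d u y + d y v ≡⟨ sym on-y ⟩
      d u v         ∎

  private
    outside : ∀ {C : Subset n} {w z} → w ∈ C → ¬ z ∈ C → z ≢ w
    outside w∈C z∉C refl = z∉C w∈C

  cover-resolves : ∀ (C : Subset n) → (∀ u v → u ≢ v → MutuallyMaxDistant G u v → u ∈ C ⊎ v ∈ C) →
                   ∀ x y → x ≢ y → ¬ x ∈ C → ¬ y ∈ C →
                   ∃ λ u → u ∈ C × StronglyResolves G (singleton u) x y
  cover-resolves C covers x y x≢y x∉C y∉C =
    let (u , v , mmd , u≢v , on-x , on-y) = between-boundary-pair x y x≢y in
    [ (λ u∈C → u , u∈C , singleton-resolves (outside u∈C x∉C) (outside u∈C y∉C) (inj₂ on-x))
    , (λ v∈C → v , v∈C , singleton-resolves (outside v∈C x∉C) (outside v∈C y∉C) (inj₁ on-y))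
    ] (covers u v u≢v mmd)

-- The labelling induced by a subset C: the members of C get the pairwise
-- distinct labels below ∣C∣, all other vertices get the label ∣C∣.
rank : ∀ {n} (C : Subset n) → Fin n → Fin (suc ∣ C ∣)
rank (true  ∷ C) Fin.zero    = Fin.zero
rank (true  ∷ C) (Fin.suc x) = Fin.suc (rank C x)
rank (false ∷ C) Fin.zero    = fromℕ ∣ C ∣
rank (false ∷ C) (Fin.suc x) = rank C x

rank-∉ : ∀ {n} (C : Subset n) x → ¬ x ∈ C → rank C x ≡ fromℕ ∣ C ∣
rank-∉ (true  ∷ C) Fin.zero    x∉C = contradiction here x∉C
rank-∉ (true  ∷ C) (Fin.suc x) x∉C = cong Fin.suc (rank-∉ C x (λ x∈C → x∉C (there x∈C)))
rank-∉ (false ∷ C) Fin.zero    _   = refl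
rank-∉ (false ∷ C) (Fin.suc x) x∉C = rank-∉ C x (λ x∈C → x∉C (there x∈C))

rank-∈ : ∀ {n} (C : Subset n) x → x ∈ C → rank C x ≢ fromℕ ∣ C ∣
rank-∈ (true  ∷ C) Fin.zero    _           ()
rank-∈ (true  ∷ C) (Fin.suc x) (there x∈C) eq = rank-∈ C x x∈C (suc-injective eq)
rank-∈ (false ∷ C) (Fin.suc x) (there x∈C) eq = rank-∈ C x x∈C eq

rank-injective : ∀ {n} (C : Subset n) {x y} → x ∈ C → y ∈ C → rank C x ≡ rank C y → x ≡ y
rank-injective (true  ∷ C) {Fin.zero}  {Fin.zero}  _ _ _ = refl
rank-injective (true  ∷ C) {Fin.zero}  {Fin.suc y} _ _ ()
rank-injective (true  ∷ C) {Fin.suc x} {Fin.zero}  _ _ ()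
rank-injective (true  ∷ C) {Fin.suc x} {Fin.suc y} (there x∈C) (there y∈C) eq =
  cong Fin.suc (rank-injective C x∈C y∈C (suc-injective eq))
rank-injective (false ∷ C) {Fin.suc x} {Fin.suc y} (there x∈C) (there y∈C) eq =
  cong Fin.suc (rank-injective C x∈C y∈C eq)

rank-class-∈ : ∀ {n} (C : Subset n) {u} → u ∈ C → ∀ w → partSet (rank C) (rank C u) w ≡ singleton u w
rank-class-∈ C {u} u∈C w = ⌊⌋-⇔ (rank C w ≟ rank C u) (w ≟ u) same-class (cong (rank C))
  where
  same-class : rank C w ≡ rank C u → w ≡ u
  same-class eq with w ∈? C
  ... | yes w∈C = rank-injective C w∈C u∈C eq
  ... | no  w∉C = contradiction (trans (sym eq) (rank-∉ C w w∉C)) (rank-∈ C u u∈C)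

rank-class-∉ : ∀ {n} (C : Subset n) {x y} → x ≢ y → rank C x ≡ rank C y → ¬ x ∈ C × ¬ y ∈ C
rank-class-∉ C {x} {y} x≢y eq with x ∈? C | y ∈? C
... | yes x∈C | yes y∈C = contradiction (rank-injective C x∈C y∈C eq) x≢y
... | yes x∈C | no  y∉C = contradiction (trans eq (rank-∉ C y y∉C)) (rank-∈ C x x∈C)
... | no  x∉C | yes y∈C = contradiction (trans (sym eq) (rank-∉ C x x∉C)) (rank-∈ C y y∈C)
... | no  x∉C | no  y∉C = x∉C , y∉C

SeparatesStrongly : ∀ {n m} → Graph n → (Fin n → Fin m) → Set
SeparatesStrongly {n} G f =
  ∀ (x y : Fin n) → x ≢ y → f x ≡ f y → ∃ λ u → StronglyResolves G (partSet f (f u)) x y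

cover-labelling-separates : ∀ {n} (G : Graph n) (C : Subset n) →
  (∀ u v → u ≢ v → MutuallyMaxDistant G u v → u ∈ C ⊎ v ∈ C) →
  SeparatesStrongly G (rank C)
cover-labelling-separates G C covers x y x≢y eq =
  let (x∉C , y∉C)          = rank-class-∉ C x≢y eq
      (u , u∈C , resolves) = cover-resolves G C covers x y x≢y x∉C y∉C
  in u , resolves-cong G (λ w → sym (rank-class-∈ C u∈C w)) resolves

record ImageFactorisation {n m : ℕ} (f : Fin n → Fin m) : Set where
  field
    size            : ℕ
    onto            : Fin n → Fin size
    embed           : Fin size → Fin m
    onto-surjective : ∀ i → ∃ λ x → onto x ≡ i
    embed-injective : Injective _≡_ _≡_ embed
    factors         : ∀ x → f x ≡ embed (onto x)

extend-factorisation-old : ∀ {n m} (f : Fin (suc n) → Fin m) (I : ImageFactorisation (λ x → f (Fin.suc x))) →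
  (i : Fin (ImageFactorisation.size I)) → ImageFactorisation.embed I i ≡ f Fin.zero → ImageFactorisation f
extend-factorisation-old {n} f I i embed-i = record
  { size = size ; onto = onto′ ; embed = embed
  ; onto-surjective = λ j → let (x , eq) = onto-surjective j in Fin.suc x , eq
  ; embed-injective = embed-injective ; factors = factors′ }
  where
  open ImageFactorisation I
  onto′ : Fin (suc n) → Fin size
  onto′ Fin.zero    = i
  onto′ (Fin.suc x) = onto x
  factors′ : ∀ x → f x ≡ embed (onto′ x)
  factors′ Fin.zero    = sym embed-i
  factors′ (Fin.suc x) = factors x

extend-factorisation-new : ∀ {n m} (f : Fin (suc n) → Fin m) (I : ImageFactorisation (λ x → f (Fin.suc x))) →
  ¬ (∃ λ i → ImageFactorisation.embed I i ≡ f Fin.zero) → ImageFactorisation f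
extend-factorisation-new {n} {m} f I new = record
  { size = suc size ; onto = onto′ ; embed = embed′
  ; onto-surjective = surjective′ ; embed-injective = injective′ ; factors = factors′ }
  where
  open ImageFactorisation I
  onto′ : Fin (suc n) → Fin (suc size)
  onto′ Fin.zero    = Fin.zero
  onto′ (Fin.suc x) = Fin.suc (onto x)
  embed′ : Fin (suc size) → Fin m
  embed′ Fin.zero    = f Fin.zero
  embed′ (Fin.suc i) = embed i
  surjective′ : ∀ j → ∃ λ x → onto′ x ≡ j
  surjective′ Fin.zero    = Fin.zero , refl
  surjective′ (Fin.suc j) = let (x , eq) = onto-surjective j in Fin.suc x , cong Fin.suc eq
  injective′ : Injective _≡_ _≡_ embed′
  injective′ {Fin.zero}  {Fin.zero}  _  = refl
  injective′ {Fin.zero}  {Fin.suc j} eq = contradiction (j , sym eq) new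
  injective′ {Fin.suc i} {Fin.zero}  eq = contradiction (i , eq) new
  injective′ {Fin.suc i} {Fin.suc j} eq = cong Fin.suc (embed-injective eq)
  factors′ : ∀ x → f x ≡ embed′ (onto′ x)
  factors′ Fin.zero    = refl
  factors′ (Fin.suc x) = factors x

image-factorisation : ∀ {n m} (f : Fin n → Fin m) → ImageFactorisation f
image-factorisation {zero} f = record
  { size = 0 ; onto = λ () ; embed = λ () ; onto-surjective = λ ()
  ; embed-injective = λ { {()} } ; factors = λ () }
image-factorisation {suc n} f with image-factorisation (λ x → f (Fin.suc x))
... | I with any? (λ i → ImageFactorisation.embed I i ≟ f Fin.zero)
...   | yes (i , embed-i) = extend-factorisation-old f I i embed-i
...   | no  new           = extend-factorisation-new f I new

strong-resolving-partition : ∀ {n m} (G : Graph n) (f : Fin n → Fin m) → SeparatesStrongly G f →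
  ∃ λ k → Σ (Fin n → Fin k) λ part → IsStrongResolvingPartition G k part × k ≤ m
strong-resolving-partition G f separates =
  size , onto , (onto-surjective , resolving) , injective⇒≤ embed-injective
  where
  open ImageFactorisation (image-factorisation f)
  onto-class : ∀ {x y} → f x ≡ f y → onto x ≡ onto y
  onto-class eq = embed-injective (trans (sym (factors _)) (trans eq (factors _)))
  f-class : ∀ {x y} → onto x ≡ onto y → f x ≡ f y
  f-class {x} {y} eq = trans (factors x) (trans (cong embed eq) (sym (factors y)))
  resolving : ∀ x y → x ≢ y → onto x ≡ onto y → ∃ λ i → StronglyResolves G (partSet onto i) x y
  resolving x y x≢y eq =
    let (u , resolves) = separates x y x≢y (f-class eq)
    in onto u , resolves-cong G (λ w → ⌊⌋-⇔ (f w ≟ f u) (onto w ≟ onto u) onto-class f-class) resolves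

theorem4 : ∀ {n : ℕ} (G : Graph n) → Connected G →
    ∀ (p a : ℕ) → IsStrongPartitionDimension G p → IsSRVertexCoverNumber G a →
    p ≤ a + 1
theorem4 G _ p a (_ , minimal) ((C , (_ , covers) , ∣C∣≡a) , _) =
  let (k , part , resolving , k≤∣C∣+1) =
        strong-resolving-partition G (rank C) (cover-labelling-separates G C covers)
  in ≤-trans (minimal k part resolving) (subst (k ≤_) (trans (cong suc ∣C∣≡a) (+-comm 1 a)) k≤∣C∣+1)
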